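{- Let $\mathbf{A}$ be a Bochvar algebra and let $\{\mathbf{A}_i\}_{i\in I}$, $(I,\vee,i_0)$, $\{p_{ij}\}_{i\le j}$ be the Płonka decomposition of its involutive-bisemilattice reduct. Then: (1) all homomorphisms $p_{ij}$ ($i\le j$) are surjective, and $p_{i_0i}$ is not injective for every $i\ne i_0$; (2) for every $i\in I$ there is an element $a_i\in A_{i_0}$ such that the restriction of $p_{i_0i}$ to the interval Boolean algebra $[0,a_i]$ of $\mathbf{A}_{i_0}$ is an isomorphism onto $\mathbf{A}_i$ whose inverse is the restriction of $J_2$ to $A_i$; moreover $a_i\ne a_j$ whenever $i\ne j$, and $a_j<a_i$ whenever $i<j$. Moreover, the decomposition is unique up to isomorphism in the following sense: if $\mathbf{A},\mathbf{B}$ are Bochvar algebras and $\Phi$ is an isomorphism between their $\{\wedge,\vee,\neg,0,1\}$-reducts, then $\Phi$ also preserves $J_0,J_1,J_2$, so $\Phi$ is an isomorphism of Bochvar algebras $\mathbf{A}\cong\mathbf{B}$.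
   Context: Let $\mathbf{WK}^e$ be the three-element algebra on $\{0,\tfrac12,1\}$ with $\neg 1=0,\neg\tfrac12=\tfrac12,\neg0=1$; $\vee,\wedge$ equal to $\tfrac12$ when one argument is $\tfrac12$ and Boolean otherwise; $J_0:0\mapsto1,\tfrac12\mapsto0,1\mapsto0$; $J_1:\tfrac12\mapsto1$, $0,1\mapsto 0$; $J_2:1\mapsto1$, $0,\tfrac12\mapsto0$. Bochvar algebras are the members of the quasivariety $\mathsf{BCA}=ISP(\mathbf{WK}^e)$. The $\{\wedge,\vee,\neg,0,1\}$-reduct of every Bochvar algebra is an involutive bisemilattice, and every involutive bisemilattice is (uniquely up to isomorphism) a Płonka sum of Boolean algebras: a join-semilattice $(I,\vee)$ with least element $i_0$, Boolean algebras $\mathbf{A}_i$ ($i\in I$, fibers) with disjoint universes, Boolean homomorphisms $p_{ij}:\mathbf{A}_i\to\mathbf{A}_j$ ($i\le j$) with $p_{ii}=\mathrm{id}$, $p_{jk}\circ p_{ij}=p_{ik}$; $A=\bigcup_iA_i$, operations computed as $g(a_1,\dots,a_n)=g^{\mathbf{A}_k}(p_{i_1k}(a_1),\dots,p_{i_nk}(a_n))$ with $a_m\in A_{i_m}$, $k=i_1\vee\dots\vee i_n$, constants from $\mathbf{A}_{i_0}$ (the Płonka decomposition). For $c\in A_{i_0}$, the interval Boolean algebra $[0,c]$ has universe $\{x\in A_{i_0}:x\le c\}$, top $c$ and complement $x^*=\neg x\wedge c$. -}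

module Defs where

open import Data.Product using (Σ; ∃; _×_; _,_; proj₁; proj₂)
open import Relation.Binary.PropositionalEquality using (_≡_; refl; sym; trans; cong; cong₂)
open import Relation.Nullary using (¬_)
import Algebra.Lattice.Structures as LS

-- The three-element algebra WK^e on {0, ½, 1}

data K3 : Set where
  k0 kh k1 : K3

negK : K3 → K3
negK k0 = k1
negK kh = kh
negK k1 = k0

andK : K3 → K3 → K3
andK kh _  = kh
andK _  kh = kh
andK k1 k1 = k1
andK k0 k0 = k0
andK k0 k1 = k0
andK k1 k0 = k0

orK : K3 → K3 → K3
orK kh _  = kh
orK _  kh = kh
orK k0 k0 = k0
orK k0 k1 = k1
orK k1 k0 = k1
orK k1 k1 = k1

J0K : K3 → K3
J0K k0 = k1
J0K kh = k0
J0K k1 = k0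

J1K : K3 → K3
J1K k0 = k0
J1K kh = k1
J1K k1 = k0

J2K : K3 → K3
J2K k0 = k0
J2K kh = k0
J2K k1 = k1

record BAlg : Set₁ where
  infixr 7 _∧_
  infixr 6 _∨_
  infix 8 ∼_
  field
    Carrier    : Set
    _∧_ _∨_    : Carrier → Carrier → Carrier
    ∼_         : Carrier → Carrier
    𝟘 𝟙        : Carrier
    J₀ J₁ J₂   : Carrier → Carrier

WKpow : (X : Set) → BAlg
WKpow X = record
  { Carrier = X → K3
  ; _∧_ = λ f g x → andK (f x) (g x)
  ; _∨_ = λ f g x → orK (f x) (g x)
  ; ∼_  = λ f x → negK (f x)
  ; 𝟘   = λ _ → k0
  ; 𝟙   = λ _ → k1
  ; J₀  = λ f x → J0K (f x)
  ; J₁  = λ f x → J1K (f x)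
  ; J₂  = λ f x → J2K (f x)
  }

-- embeddings into powers of WK^e; equality in the power is pointwise
-- (elements of the power are functions; no function extensionality)
IsEmbeddingIntoPower : (A : BAlg) (X : Set) → (BAlg.Carrier A → X → K3) → Set
IsEmbeddingIntoPower A X f =
  (∀ a b x → f (a ∧ b) x ≡ andK (f a x) (f b x)) ×
  (∀ a b x → f (a ∨ b) x ≡ orK (f a x) (f b x)) ×
  (∀ a x → f (∼ a) x ≡ negK (f a x)) ×
  (∀ x → f 𝟘 x ≡ k0) ×
  (∀ x → f 𝟙 x ≡ k1) ×
  (∀ a x → f (J₀ a) x ≡ J0K (f a x)) ×
  (∀ a x → f (J₁ a) x ≡ J1K (f a x)) ×
  (∀ a x → f (J₂ a) x ≡ J2K (f a x)) ×
  (∀ a b → (∀ x → f a x ≡ f b x) → a ≡ b)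
  where open BAlg A

-- Bochvar algebras: BCA = ISP(WK^e), i.e. algebras embeddable in a power of WK^e
IsBochvar : BAlg → Set₁
IsBochvar A = Σ Set λ X → Σ (BAlg.Carrier A → X → K3) λ f → IsEmbeddingIntoPower A X f

-- Płonka decomposition of the {∧,∨,¬,0,1}-reduct of A, presented
-- internally: a semilattice of indices (I, ⊔, i₀), a fiber map
-- idx : A → I (A_i = {a | idx a ≡ i}) and transition maps p i j (for i ≤ j,
-- i.e. i ⊔ j ≡ j; the order proof is irrelevant), acting on A_i.

record PlonkaData (A : BAlg) : Set₁ where
  open BAlg A
  field
    I        : Set
    _⊔_      : I → I → I
    i₀       : I
    ⊔-assoc  : ∀ i j k → (i ⊔ j) ⊔ k ≡ i ⊔ (j ⊔ k)
    ⊔-comm   : ∀ i j → i ⊔ j ≡ j ⊔ i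
    ⊔-idem   : ∀ i → i ⊔ i ≡ i
    ⊔-least  : ∀ i → i₀ ⊔ i ≡ i
    idx      : Carrier → I
    idx-𝟘    : idx 𝟘 ≡ i₀
    idx-𝟙    : idx 𝟙 ≡ i₀
    idx-∧    : ∀ a b → idx (a ∧ b) ≡ idx a ⊔ idx b
    idx-∨    : ∀ a b → idx (a ∨ b) ≡ idx a ⊔ idx b
    idx-¬    : ∀ a → idx (∼ a) ≡ idx a
    p        : (i j : I) → .(i ⊔ j ≡ j) → Carrier → Carrier
    p-fiber  : ∀ i j .(h : i ⊔ j ≡ j) a → idx a ≡ i → idx (p i j h a) ≡ j

module PlonkaFibers {A : BAlg} (D : PlonkaData A) where
  open BAlg A
  open PlonkaData D

  Fiber : I → Set
  Fiber i = Σ Carrier λ a → idx a ≡ i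

  _≈F_ : ∀ {i} → Fiber i → Fiber i → Set
  x ≈F y = proj₁ x ≡ proj₁ y

  _∧F_ : ∀ {i} → Fiber i → Fiber i → Fiber i
  _∧F_ {i} (a , pa) (b , pb) = (a ∧ b) , trans (idx-∧ a b) (trans (cong₂ _⊔_ pa pb) (⊔-idem i))

  _∨F_ : ∀ {i} → Fiber i → Fiber i → Fiber i
  _∨F_ {i} (a , pa) (b , pb) = (a ∨ b) , trans (idx-∨ a b) (trans (cong₂ _⊔_ pa pb) (⊔-idem i))

  ¬F_ : ∀ {i} → Fiber i → Fiber i
  ¬F (a , pa) = (∼ a) , trans (idx-¬ a) pa

  ⊥F : ∀ i → Fiber i
  ⊥F i = p i₀ i (⊔-least i) 𝟘 , p-fiber i₀ i (⊔-least i) 𝟘 idx-𝟘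

  ⊤F : ∀ i → Fiber i
  ⊤F i = p i₀ i (⊔-least i) 𝟙 , p-fiber i₀ i (⊔-least i) 𝟙 idx-𝟙

  IsBooleanFiber : I → Set
  IsBooleanFiber i = LS.IsBooleanAlgebra (_≈F_ {i}) _∨F_ _∧F_ ¬F_ (⊤F i) (⊥F i)

record IsPlonkaDecomposition {A : BAlg} (D : PlonkaData A) : Set where
  open BAlg A
  open PlonkaData D
  open PlonkaFibers D
  field
    fibers-Boolean : ∀ i → IsBooleanFiber i
    p-id    : ∀ i .(h : i ⊔ i ≡ i) a → idx a ≡ i → p i i h a ≡ a
    p-comp  : ∀ i j k .(hij : i ⊔ j ≡ j) .(hjk : j ⊔ k ≡ k) .(hik : i ⊔ k ≡ k) a →
              idx a ≡ i → p j k hjk (p i j hij a) ≡ p i k hik a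
    p-∧     : ∀ i j .(h : i ⊔ j ≡ j) a b → idx a ≡ i → idx b ≡ i →
              p i j h (a ∧ b) ≡ p i j h a ∧ p i j h b
    p-∨     : ∀ i j .(h : i ⊔ j ≡ j) a b → idx a ≡ i → idx b ≡ i →
              p i j h (a ∨ b) ≡ p i j h a ∨ p i j h b
    p-¬     : ∀ i j .(h : i ⊔ j ≡ j) a → idx a ≡ i →
              p i j h (∼ a) ≡ ∼ (p i j h a)
    ∧-sum   : ∀ a b .(h₁ : idx a ⊔ (idx a ⊔ idx b) ≡ idx a ⊔ idx b)
                    .(h₂ : idx b ⊔ (idx a ⊔ idx b) ≡ idx a ⊔ idx b) →
              a ∧ b ≡ p (idx a) (idx a ⊔ idx b) h₁ a ∧ p (idx b) (idx a ⊔ idx b) h₂ b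
    ∨-sum   : ∀ a b .(h₁ : idx a ⊔ (idx a ⊔ idx b) ≡ idx a ⊔ idx b)
                    .(h₂ : idx b ⊔ (idx a ⊔ idx b) ≡ idx a ⊔ idx b) →
              a ∨ b ≡ p (idx a) (idx a ⊔ idx b) h₁ a ∨ p (idx b) (idx a ⊔ idx b) h₂ b

record PlonkaDecomposition (A : BAlg) : Set₁ where
  field
    dat     : PlonkaData A
    isPlonka : IsPlonkaDecomposition dat
  open PlonkaData dat public

module _ {A : BAlg} (D : PlonkaDecomposition A) where
  open BAlg A
  open PlonkaDecomposition D

  Part1 : Set
  Part1 =
    (∀ i j .(h : i ⊔ j ≡ j) y → idx y ≡ j →
       ∃ λ x → idx x ≡ i × p i j h x ≡ y) ×
    (∀ i → ¬ (i ≡ i₀) →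
       ¬ (∀ x y → idx x ≡ i₀ → idx y ≡ i₀ →
            p i₀ i (⊔-least i) x ≡ p i₀ i (⊔-least i) y → x ≡ y))

  -- restriction of p_{i₀ i} to the interval algebra [0,c] of A_{i₀}
  -- ( universe {x ∈ A_{i₀} | x ≤ c}, x ≤ c meaning x ∧ c ≡ x, ops ∧, ∨,
  --   complement x* = ¬x ∧ c, top c, bottom 0 ) is an isomorphism onto A_i
  -- with inverse J₂ restricted to A_i
  IntervalIso : (i : I) (c : Carrier) → Set
  IntervalIso i c =
    (∀ x → idx x ≡ i₀ → x ∧ c ≡ x →
       idx (q x) ≡ i × J₂ (q x) ≡ x) ×
    (∀ y → idx y ≡ i →
       idx (J₂ y) ≡ i₀ × J₂ y ∧ c ≡ J₂ y × q (J₂ y) ≡ y) ×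
    (∀ x y → idx x ≡ i₀ → x ∧ c ≡ x → idx y ≡ i₀ → y ∧ c ≡ y →
       q (x ∧ y) ≡ q x ∧ q y) ×
    (∀ x y → idx x ≡ i₀ → x ∧ c ≡ x → idx y ≡ i₀ → y ∧ c ≡ y →
       q (x ∨ y) ≡ q x ∨ q y) ×
    (∀ x → idx x ≡ i₀ → x ∧ c ≡ x → q (∼ x ∧ c) ≡ ∼ (q x)) ×
    (q c ≡ proj₁ (PlonkaFibers.⊤F dat i)) ×
    (q 𝟘 ≡ proj₁ (PlonkaFibers.⊥F dat i))
    where
      q : Carrier → Carrier
      q = p i₀ i (⊔-least i)

  Part2 : Set
  Part2 = Σ (I → Carrier) λ a →
    (∀ i → idx (a i) ≡ i₀) ×
    (∀ i → IntervalIso i (a i)) ×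
    (∀ i j → ¬ (i ≡ j) → ¬ (a i ≡ a j)) ×
    (∀ i j → i ⊔ j ≡ j → ¬ (i ≡ j) → (a j ∧ a i ≡ a j) × ¬ (a j ≡ a i))

IsReductIso : (A B : BAlg) → (BAlg.Carrier A → BAlg.Carrier B) → Set
IsReductIso A B Φ =
  (∀ a b → Φ (a A.∧ b) ≡ Φ a B.∧ Φ b) ×
  (∀ a b → Φ (a A.∨ b) ≡ Φ a B.∨ Φ b) ×
  (∀ a → Φ (A.∼ a) ≡ B.∼ (Φ a)) ×
  (Φ A.𝟘 ≡ B.𝟘) ×
  (Φ A.𝟙 ≡ B.𝟙) ×
  (∀ a b → Φ a ≡ Φ b → a ≡ b) ×
  (∀ b → ∃ λ a → Φ a ≡ b)
  where
    module A = BAlg A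
    module B = BAlg B

PreservesJ : (A B : BAlg) → (BAlg.Carrier A → BAlg.Carrier B) → Set
PreservesJ A B Φ =
  (∀ a → Φ (BAlg.J₀ A a) ≡ BAlg.J₀ B (Φ a)) ×
  (∀ a → Φ (BAlg.J₁ A a) ≡ BAlg.J₁ B (Φ a)) ×
  (∀ a → Φ (BAlg.J₂ A a) ≡ BAlg.J₂ B (Φ a))

-- In a subalgebra of a power of WK^e, identities can be checked coordinatewise.
-- The fiber A_i consists of the elements whose coordinates are ½ exactly where
-- those of its top t_i = p_{i₀i}(1) are, and t_i takes only the values 1 and ½.
-- Hence p_{ij}(x) = x ∧ t_j, the Boolean elements form A_{i₀}, and J₂ y is the
-- least Boolean u projecting onto y, i.e. with u ∧ (y ∨ ¬y) = y. Taking
-- a_i = J₂ t_i, projection and J₂ are mutually inverse between [0, a_i] and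
-- A_i; surjectivity of the p_{ij} and the order properties of the a_i follow.
-- Since J₂ is defined from the reduct by that minimality property, and
-- J₀ y = J₂ ¬y, J₁ y = ¬(J₂ y ∨ J₂ ¬y), reduct isomorphisms preserve all J's.
module Submission where

open import Defs
open import Data.Product using (∃; _×_; _,_; proj₁; proj₂)
open import Relation.Binary.PropositionalEquality
open import Relation.Nullary using (¬_)
import Algebra.Lattice.Structures as LS

J2K-boolean : ∀ v → orK (J2K v) (negK (J2K v)) ≡ k1
J2K-boolean k0 = refl
J2K-boolean kh = refl
J2K-boolean k1 = refl

J2K-∧-support : ∀ v → andK (J2K v) (orK v (negK v)) ≡ v
J2K-∧-support k0 = refl
J2K-∧-support kh = refl
J2K-∧-support k1 = refl

J2K-least : ∀ v u → orK u (negK u) ≡ k1 → andK u (orK v (negK v)) ≡ v →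
            andK (J2K v) u ≡ J2K v
J2K-least _  kh () _
J2K-least k0 k0 _  _ = refl
J2K-least kh k0 _  _ = refl
J2K-least k0 k1 _  ()
J2K-least kh k1 _  _ = refl
J2K-least k1 k0 _  ()
J2K-least k1 k1 _  _ = refl

andK-comm : ∀ v w → andK v w ≡ andK w v
andK-comm k0 k0 = refl
andK-comm k0 kh = refl
andK-comm k0 k1 = refl
andK-comm kh k0 = refl
andK-comm kh kh = refl
andK-comm kh k1 = refl
andK-comm k1 k0 = refl
andK-comm k1 kh = refl
andK-comm k1 k1 = refl

J0K-via-J2K : ∀ v → J0K v ≡ J2K (negK v)
J0K-via-J2K k0 = refl
J0K-via-J2K kh = refl
J0K-via-J2K k1 = refl

J1K-via-J2K : ∀ v → J1K v ≡ negK (orK (J2K v) (J2K (negK v)))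
J1K-via-J2K k0 = refl
J1K-via-J2K kh = refl
J1K-via-J2K k1 = refl

J2K-≤-J2K-support : ∀ v → andK (J2K v) (J2K (orK v (negK v))) ≡ J2K v
J2K-≤-J2K-support k0 = refl
J2K-≤-J2K-support kh = refl
J2K-≤-J2K-support k1 = refl

J2K-injective-regular : ∀ w w' → orK w (negK w) ≡ w → orK w' (negK w') ≡ w' →
                        J2K w ≡ J2K w' → w ≡ w'
J2K-injective-regular k0 _  () _  _
J2K-injective-regular kh k0 _  () _
J2K-injective-regular kh kh _  _  _ = refl
J2K-injective-regular kh k1 _  _  ()
J2K-injective-regular k1 k0 _  () _
J2K-injective-regular k1 kh _  _  ()
J2K-injective-regular k1 k1 _  _  _ = refl

J2K-∧-regular : ∀ v w → orK v (negK v) ≡ k1 → andK v (J2K w) ≡ v →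
                orK w (negK w) ≡ w → J2K (andK v w) ≡ v
J2K-∧-regular _  k0 _  _  ()
J2K-∧-regular kh _  () _  _
J2K-∧-regular k0 kh _  _  _ = refl
J2K-∧-regular k0 k1 _  _  _ = refl
J2K-∧-regular k1 kh _  () _
J2K-∧-regular k1 k1 _  _  _ = refl

module _ (A : BAlg) where
  open BAlg A

  IsBoolean : Carrier → Set
  IsBoolean u = u ∨ ∼ u ≡ 𝟙

  -- u ∧ (y ∨ ∼ y) is the image of u in the Płonka fiber of y.
  IsLeastBooleanPreimage : Carrier → Carrier → Set
  IsLeastBooleanPreimage y u =
    IsBoolean u × u ∧ (y ∨ ∼ y) ≡ y ×
    (∀ u' → IsBoolean u' → u' ∧ (y ∨ ∼ y) ≡ y → u ∧ u' ≡ u)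

module BochvarAlgebra {A : BAlg} (X : Set) (f : BAlg.Carrier A → X → K3)
                      (f-embedding : IsEmbeddingIntoPower A X f) where
  open BAlg A

  f-∧ : ∀ a b x → f (a ∧ b) x ≡ andK (f a x) (f b x)
  f-∧ = proj₁ f-embedding

  f-∨ : ∀ a b x → f (a ∨ b) x ≡ orK (f a x) (f b x)
  f-∨ = proj₁ (proj₂ f-embedding)

  f-∼ : ∀ a x → f (∼ a) x ≡ negK (f a x)
  f-∼ = proj₁ (proj₂ (proj₂ f-embedding))

  f-𝟙 : ∀ x → f 𝟙 x ≡ k1
  f-𝟙 = proj₁ (proj₂ (proj₂ (proj₂ (proj₂ f-embedding))))

  f-J₀ : ∀ a x → f (J₀ a) x ≡ J0K (f a x)
  f-J₀ = proj₁ (proj₂ (proj₂ (proj₂ (proj₂ (proj₂ f-embedding)))))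

  f-J₁ : ∀ a x → f (J₁ a) x ≡ J1K (f a x)
  f-J₁ = proj₁ (proj₂ (proj₂ (proj₂ (proj₂ (proj₂ (proj₂ f-embedding))))))

  f-J₂ : ∀ a x → f (J₂ a) x ≡ J2K (f a x)
  f-J₂ = proj₁ (proj₂ (proj₂ (proj₂ (proj₂ (proj₂ (proj₂ (proj₂ f-embedding)))))))

  pointwise : ∀ {a b} → (∀ x → f a x ≡ f b x) → a ≡ b
  pointwise = proj₂ (proj₂ (proj₂ (proj₂ (proj₂ (proj₂ (proj₂ (proj₂ f-embedding))))))) _ _

  at : ∀ {a b} → a ≡ b → ∀ x → f a x ≡ f b x
  at eq x = cong (λ c → f c x) eq

  f-∨∼ : ∀ a x → f (a ∨ ∼ a) x ≡ orK (f a x) (negK (f a x))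
  f-∨∼ a x = trans (f-∨ a (∼ a) x) (cong (orK (f a x)) (f-∼ a x))

  boolean-at : ∀ {u} → IsBoolean A u → ∀ x → orK (f u x) (negK (f u x)) ≡ k1
  boolean-at {u} b x = trans (sym (f-∨∼ u x)) (trans (at b x) (f-𝟙 x))

  regular-at : ∀ {t} → t ∨ ∼ t ≡ t → ∀ x → orK (f t x) (negK (f t x)) ≡ f t x
  regular-at {t} r x = trans (sym (f-∨∼ t x)) (at r x)

  ∧-at : ∀ {a b c} → a ∧ b ≡ c → ∀ x → andK (f a x) (f b x) ≡ f c x
  ∧-at {a} {b} eq x = trans (sym (f-∧ a b x)) (at eq x)

  ∧-comm : ∀ a b → a ∧ b ≡ b ∧ a
  ∧-comm a b = pointwise λ x →
    trans (f-∧ a b x) (trans (andK-comm (f a x) (f b x)) (sym (f-∧ b a x)))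

  J₂-isBoolean : ∀ y → IsBoolean A (J₂ y)
  J₂-isBoolean y = pointwise λ x →
    trans (f-∨∼ (J₂ y) x)
      (trans (cong (λ v → orK v (negK v)) (f-J₂ y x))
        (trans (J2K-boolean (f y x)) (sym (f-𝟙 x))))

  J₂-leastBooleanPreimage : ∀ y → IsLeastBooleanPreimage A y (J₂ y)
  J₂-leastBooleanPreimage y = J₂-isBoolean y , pointwise support , least
    where
    support : ∀ x → f (J₂ y ∧ (y ∨ ∼ y)) x ≡ f y x
    support x rewrite f-∧ (J₂ y) (y ∨ ∼ y) x | f-∨∼ y x | f-J₂ y x =
      J2K-∧-support (f y x)
    least : ∀ u → IsBoolean A u → u ∧ (y ∨ ∼ y) ≡ y → J₂ y ∧ u ≡ J₂ y
    least u b preimage = pointwise λ x →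
      trans (f-∧ (J₂ y) u x)
        (trans (cong (λ v → andK v (f u x)) (f-J₂ y x))
          (trans (J2K-least (f y x) (f u x) (boolean-at b x)
                   (trans (cong (andK (f u x)) (sym (f-∨∼ y x))) (∧-at preimage x)))
            (sym (f-J₂ y x))))

  leastBooleanPreimage-unique : ∀ {y u u'} → IsLeastBooleanPreimage A y u →
                                IsLeastBooleanPreimage A y u' → u ≡ u'
  leastBooleanPreimage-unique {u = u} {u'} (b , p , least) (b' , p' , least') =
    trans (sym (least u' b' p')) (trans (∧-comm u u') (least' u b p))

  J₀≡J₂∼ : ∀ y → J₀ y ≡ J₂ (∼ y)
  J₀≡J₂∼ y = pointwise λ x →
    trans (f-J₀ y x) (trans (J0K-via-J2K (f y x))
      (sym (trans (f-J₂ (∼ y) x) (cong J2K (f-∼ y x)))))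

  J₁≡∼[J₂∨J₂∼] : ∀ y → J₁ y ≡ ∼ (J₂ y ∨ J₂ (∼ y))
  J₁≡∼[J₂∨J₂∼] y = pointwise eq
    where
    eq : ∀ x → f (J₁ y) x ≡ f (∼ (J₂ y ∨ J₂ (∼ y))) x
    eq x rewrite f-J₁ y x | f-∼ (J₂ y ∨ J₂ (∼ y)) x | f-∨ (J₂ y) (J₂ (∼ y)) x
               | f-J₂ y x | f-J₂ (∼ y) x | f-∼ y x = J1K-via-J2K (f y x)

  J₂-𝟙 : J₂ 𝟙 ≡ 𝟙
  J₂-𝟙 = pointwise λ x → trans (f-J₂ 𝟙 x) (trans (cong J2K (f-𝟙 x)) (sym (f-𝟙 x)))

  J₂-≤-J₂∨∼ : ∀ y → J₂ y ∧ J₂ (y ∨ ∼ y) ≡ J₂ y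
  J₂-≤-J₂∨∼ y = pointwise eq
    where
    eq : ∀ x → f (J₂ y ∧ J₂ (y ∨ ∼ y)) x ≡ f (J₂ y) x
    eq x rewrite f-∧ (J₂ y) (J₂ (y ∨ ∼ y)) x | f-J₂ (y ∨ ∼ y) x | f-∨∼ y x | f-J₂ y x =
      J2K-≤-J2K-support (f y x)

  J₂-injective-regular : ∀ {t t'} → t ∨ ∼ t ≡ t → t' ∨ ∼ t' ≡ t' →
                         J₂ t ≡ J₂ t' → t ≡ t'
  J₂-injective-regular {t} {t'} r r' eq = pointwise λ x →
    J2K-injective-regular (f t x) (f t' x) (regular-at r x) (regular-at r' x)
      (trans (sym (f-J₂ t x)) (trans (at eq x) (f-J₂ t' x)))

  J₂-∧-regular : ∀ {u t} → IsBoolean A u → u ∧ J₂ t ≡ u → t ∨ ∼ t ≡ t →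
                 J₂ (u ∧ t) ≡ u
  J₂-∧-regular {u} {t} b le r = pointwise λ x →
    trans (f-J₂ (u ∧ t) x) (trans (cong J2K (f-∧ u t x))
      (J2K-∧-regular (f u x) (f t x) (boolean-at b x)
        (trans (cong (andK (f u x)) (sym (f-J₂ t x))) (∧-at le x)) (regular-at r x)))

  module Decomposition (D : PlonkaDecomposition A) where
    open PlonkaDecomposition D
    open IsPlonkaDecomposition isPlonka
    open PlonkaFibers dat

    top : I → Carrier
    top i = proj₁ (⊤F i)

    top-idx : ∀ i → idx (top i) ≡ i
    top-idx i = proj₂ (⊤F i)

    top-i₀ : top i₀ ≡ 𝟙
    top-i₀ = p-id i₀ (⊔-least i₀) 𝟙 idx-𝟙

    ∨-compl-top : ∀ {i} x → idx x ≡ i → x ∨ ∼ x ≡ top i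
    ∨-compl-top {i} x ix = LS.IsBooleanAlgebra.∨-complementʳ (fibers-Boolean i) (x , ix)

    ∧-top : ∀ {i} x → idx x ≡ i → x ∧ top i ≡ x
    ∧-top {i} x ix =
      trans (cong (x ∧_) (sym (∨-compl-top x ix)))
        (LS.IsBooleanAlgebra.∧-absorbs-∨ (fibers-Boolean i) (x , ix) (¬F (x , ix)))

    top-regular : ∀ i → top i ∨ ∼ top i ≡ top i
    top-regular i = ∨-compl-top (top i) (top-idx i)

    idx≡i₀⇒boolean : ∀ {x} → idx x ≡ i₀ → IsBoolean A x
    idx≡i₀⇒boolean {x} ix = trans (∨-compl-top x ix) top-i₀

    boolean⇒idx≡i₀ : ∀ {u} → IsBoolean A u → idx u ≡ i₀
    boolean⇒idx≡i₀ {u} b = begin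
      idx u               ≡⟨ sym (⊔-idem (idx u)) ⟩
      idx u ⊔ idx u       ≡⟨ cong (idx u ⊔_) (sym (idx-¬ u)) ⟩
      idx u ⊔ idx (∼ u)   ≡⟨ sym (idx-∨ u (∼ u)) ⟩
      idx (u ∨ ∼ u)       ≡⟨ cong idx b ⟩
      idx 𝟙               ≡⟨ idx-𝟙 ⟩
      i₀                  ∎
      where open ≡-Reasoning

    J₂-idx : ∀ y → idx (J₂ y) ≡ i₀
    J₂-idx y = boolean⇒idx≡i₀ (J₂-isBoolean y)

    ∧-in-join-fiber : ∀ {i j k} a b → idx a ≡ i → idx b ≡ j → i ⊔ j ≡ k →
                      .(hi : i ⊔ k ≡ k) .(hj : j ⊔ k ≡ k) → a ∧ b ≡ p i k hi a ∧ p j k hj b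
    ∧-in-join-fiber a b refl refl refl = ∧-sum a b

    p≡∧top : ∀ i j (h : i ⊔ j ≡ j) a → idx a ≡ i → p i j h a ≡ a ∧ top j
    p≡∧top i j h a ia = begin
      p i j h a                    ≡⟨ sym (∧-top (p i j h a) (p-fiber i j h a ia)) ⟩
      p i j h a ∧ top j            ≡⟨ cong (p i j h a ∧_) (sym top-fixed) ⟩
      p i j h a ∧ p j j _ (top j)  ≡⟨ sym (∧-in-join-fiber a (top j) ia (top-idx j) h h (⊔-idem j)) ⟩
      a ∧ top j                    ∎
      where
      open ≡-Reasoning
      top-fixed : p j j (⊔-idem j) (top j) ≡ top j
      top-fixed = p-id j (⊔-idem j) (top j) (top-idx j)

    p₀ : I → Carrier → Carrier
    p₀ i = p i₀ i (⊔-least i)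

    p₀-J₂ : ∀ {i} y → idx y ≡ i → p₀ i (J₂ y) ≡ y
    p₀-J₂ {i} y iy = begin
      p₀ i (J₂ y)       ≡⟨ p≡∧top i₀ i (⊔-least i) (J₂ y) (J₂-idx y) ⟩
      J₂ y ∧ top i      ≡⟨ cong (J₂ y ∧_) (sym (∨-compl-top y iy)) ⟩
      J₂ y ∧ (y ∨ ∼ y)  ≡⟨ proj₁ (proj₂ (J₂-leastBooleanPreimage y)) ⟩
      y                 ∎
      where open ≡-Reasoning

    p∘p₀ : ∀ i j .(h : i ⊔ j ≡ j) x → idx x ≡ i₀ → p i j h (p₀ i x) ≡ p₀ j x
    p∘p₀ i j h = p-comp i₀ i j (⊔-least i) h (⊔-least j)

    p-surjective : ∀ i j .(h : i ⊔ j ≡ j) y → idx y ≡ j →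
                   ∃ λ x → idx x ≡ i × p i j h x ≡ y
    p-surjective i j h y iy =
      p₀ i (J₂ y) , p-fiber i₀ i (⊔-least i) (J₂ y) (J₂-idx y) ,
      trans (p∘p₀ i j h (J₂ y) (J₂-idx y)) (p₀-J₂ y iy)

    a : I → Carrier
    a i = J₂ (top i)

    a-idx : ∀ i → idx (a i) ≡ i₀
    a-idx i = J₂-idx (top i)

    p₀-a : ∀ i → p₀ i (a i) ≡ top i
    p₀-a i = p₀-J₂ (top i) (top-idx i)

    a-i₀ : a i₀ ≡ 𝟙
    a-i₀ = trans (cong J₂ top-i₀) J₂-𝟙

    a-injective : ∀ i j → ¬ (i ≡ j) → ¬ (a i ≡ a j)
    a-injective i j i≢j ai≡aj = i≢j (begin
      i            ≡⟨ sym (top-idx i) ⟩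
      idx (top i)  ≡⟨ cong idx (J₂-injective-regular (top-regular i) (top-regular j) ai≡aj) ⟩
      idx (top j)  ≡⟨ top-idx j ⟩
      j            ∎)
      where open ≡-Reasoning

    -- Both a i and 𝟙 are sent to the top of A_i.
    p₀-not-injective : ∀ i → ¬ (i ≡ i₀) →
      ¬ (∀ x y → idx x ≡ i₀ → idx y ≡ i₀ → p₀ i x ≡ p₀ i y → x ≡ y)
    p₀-not-injective i i≢i₀ injective =
      a-injective i i₀ i≢i₀ (trans (injective (a i) 𝟙 (a-idx i) idx-𝟙 (p₀-a i)) (sym a-i₀))

    a-antitone : ∀ i j → i ⊔ j ≡ j → a j ∧ a i ≡ a j
    a-antitone i j h =
      proj₂ (proj₂ (J₂-leastBooleanPreimage (top j))) (a i) (J₂-isBoolean (top i)) (begin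
        a i ∧ (top j ∨ ∼ top j)  ≡⟨ cong (a i ∧_) (top-regular j) ⟩
        a i ∧ top j              ≡⟨ sym (p≡∧top i₀ j (⊔-least j) (a i) (a-idx i)) ⟩
        p₀ j (a i)               ≡⟨ sym (p∘p₀ i j h (a i) (a-idx i)) ⟩
        p i j h (p₀ i (a i))     ≡⟨ cong (p i j h) (p₀-a i) ⟩
        p i j h (p₀ i 𝟙)         ≡⟨ p∘p₀ i j h 𝟙 idx-𝟙 ⟩
        top j                    ∎)
      where open ≡-Reasoning

    p₀-intervalIso : ∀ i → IntervalIso D i (a i)
    p₀-intervalIso i =
      (λ x ix x≤a → p-fiber i₀ i (⊔-least i) x ix , J₂-p₀ x ix x≤a) ,
      (λ y iy → J₂-idx y , J₂-≤-a y iy , p₀-J₂ y iy) ,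
      (λ x y ix _ iy _ → p-∧ i₀ i (⊔-least i) x y ix iy) ,
      (λ x y ix _ iy _ → p-∨ i₀ i (⊔-least i) x y ix iy) ,
      p₀-complement ,
      p₀-a i ,
      refl
      where
      J₂-p₀ : ∀ x → idx x ≡ i₀ → x ∧ a i ≡ x → J₂ (p₀ i x) ≡ x
      J₂-p₀ x ix x≤a = trans (cong J₂ (p≡∧top i₀ i (⊔-least i) x ix))
                            (J₂-∧-regular (idx≡i₀⇒boolean ix) x≤a (top-regular i))
      J₂-≤-a : ∀ y → idx y ≡ i → J₂ y ∧ a i ≡ J₂ y
      J₂-≤-a y iy = subst (λ t → J₂ y ∧ J₂ t ≡ J₂ y) (∨-compl-top y iy) (J₂-≤-J₂∨∼ y)
      p₀-complement : ∀ x → idx x ≡ i₀ → x ∧ a i ≡ x →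
                      p₀ i (∼ x ∧ a i) ≡ ∼ (p₀ i x)
      p₀-complement x ix _ = begin
        p₀ i (∼ x ∧ a i)         ≡⟨ p-∧ i₀ i (⊔-least i) (∼ x) (a i) (trans (idx-¬ x) ix) (a-idx i) ⟩
        p₀ i (∼ x) ∧ p₀ i (a i)  ≡⟨ cong₂ _∧_ (p-¬ i₀ i (⊔-least i) x ix) (p₀-a i) ⟩
        ∼ p₀ i x ∧ top i         ≡⟨ ∧-top (∼ p₀ i x) (trans (idx-¬ (p₀ i x)) p₀x-idx) ⟩
        ∼ p₀ i x                 ∎
        where
        open ≡-Reasoning
        p₀x-idx : idx (p₀ i x) ≡ i
        p₀x-idx = p-fiber i₀ i (⊔-least i) x ix

    part1 : Part1 D
    part1 = p-surjective , p₀-not-injective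

    part2 : Part2 D
    part2 = a , a-idx , p₀-intervalIso , a-injective ,
            λ i j h i≢j → a-antitone i j h , λ aj≡ai → a-injective i j i≢j (sym aj≡ai)

module ReductIso (A B : BAlg) (Φ : BAlg.Carrier A → BAlg.Carrier B)
                 (Φ-iso : IsReductIso A B Φ) where
  private
    module A = BAlg A
    module B = BAlg B

  Φ-∧ : ∀ a b → Φ (a A.∧ b) ≡ Φ a B.∧ Φ b
  Φ-∧ = proj₁ Φ-iso

  Φ-∨ : ∀ a b → Φ (a A.∨ b) ≡ Φ a B.∨ Φ b
  Φ-∨ = proj₁ (proj₂ Φ-iso)

  Φ-∼ : ∀ a → Φ (A.∼ a) ≡ B.∼ (Φ a)
  Φ-∼ = proj₁ (proj₂ (proj₂ Φ-iso))

  Φ-𝟙 : Φ A.𝟙 ≡ B.𝟙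
  Φ-𝟙 = proj₁ (proj₂ (proj₂ (proj₂ (proj₂ Φ-iso))))

  Φ-injective : ∀ a b → Φ a ≡ Φ b → a ≡ b
  Φ-injective = proj₁ (proj₂ (proj₂ (proj₂ (proj₂ (proj₂ Φ-iso)))))

  Φ-surjective : ∀ b → ∃ λ a → Φ a ≡ b
  Φ-surjective = proj₂ (proj₂ (proj₂ (proj₂ (proj₂ (proj₂ Φ-iso)))))

  Φ-∨∼ : ∀ a → Φ (a A.∨ A.∼ a) ≡ Φ a B.∨ B.∼ Φ a
  Φ-∨∼ a = trans (Φ-∨ a (A.∼ a)) (cong (Φ a B.∨_) (Φ-∼ a))

  Φ-preimage : ∀ y u → u A.∧ (y A.∨ A.∼ y) ≡ y → Φ u B.∧ (Φ y B.∨ B.∼ Φ y) ≡ Φ y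
  Φ-preimage y u eq =
    trans (cong (Φ u B.∧_) (sym (Φ-∨∼ y))) (trans (sym (Φ-∧ u _)) (cong Φ eq))

  Φ-preimage⁻¹ : ∀ y u → Φ u B.∧ (Φ y B.∨ B.∼ Φ y) ≡ Φ y → u A.∧ (y A.∨ A.∼ y) ≡ y
  Φ-preimage⁻¹ y u eq =
    Φ-injective _ _ (trans (Φ-∧ u _) (trans (cong (Φ u B.∧_) (Φ-∨∼ y)) eq))

  Φ-boolean : ∀ u → IsBoolean A u → IsBoolean B (Φ u)
  Φ-boolean u b = trans (sym (Φ-∨∼ u)) (trans (cong Φ b) Φ-𝟙)

  Φ-boolean⁻¹ : ∀ u → IsBoolean B (Φ u) → IsBoolean A u
  Φ-boolean⁻¹ u b = Φ-injective _ _ (trans (Φ-∨∼ u) (trans b (sym Φ-𝟙)))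

  Φ-leastBooleanPreimage : ∀ y u → IsLeastBooleanPreimage A y u →
                           IsLeastBooleanPreimage B (Φ y) (Φ u)
  Φ-leastBooleanPreimage y u (b , preimage , least) =
    Φ-boolean u b , Φ-preimage y u preimage , least′
    where
    least′ : ∀ v → IsBoolean B v → v B.∧ (Φ y B.∨ B.∼ Φ y) ≡ Φ y → Φ u B.∧ v ≡ Φ u
    least′ v bv preimage′ with Φ-surjective v
    ... | w , refl = trans (sym (Φ-∧ u w))
      (cong Φ (least w (Φ-boolean⁻¹ w bv) (Φ-preimage⁻¹ y w preimage′)))

reductIso-preservesJ : (A B : BAlg) → IsBochvar A → IsBochvar B →
                       (Φ : BAlg.Carrier A → BAlg.Carrier B) → IsReductIso A B Φ →
                       PreservesJ A B Φ
reductIso-preservesJ A B (X , f , f-emb) (Y , g , g-emb) Φ Φ-iso = Φ-J₀ , Φ-J₁ , Φ-J₂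
  where
  module A = BAlg A
  module B = BAlg B
  module BA = BochvarAlgebra X f f-emb
  module BB = BochvarAlgebra Y g g-emb
  open ReductIso A B Φ Φ-iso

  Φ-J₂ : ∀ a → Φ (A.J₂ a) ≡ B.J₂ (Φ a)
  Φ-J₂ a = BB.leastBooleanPreimage-unique
    (Φ-leastBooleanPreimage a (A.J₂ a) (BA.J₂-leastBooleanPreimage a))
    (BB.J₂-leastBooleanPreimage (Φ a))

  Φ-J₂∼ : ∀ a → Φ (A.J₂ (A.∼ a)) ≡ B.J₂ (B.∼ Φ a)
  Φ-J₂∼ a = trans (Φ-J₂ (A.∼ a)) (cong B.J₂ (Φ-∼ a))

  Φ-J₀ : ∀ a → Φ (A.J₀ a) ≡ B.J₀ (Φ a)
  Φ-J₀ a = begin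
    Φ (A.J₀ a)           ≡⟨ cong Φ (BA.J₀≡J₂∼ a) ⟩
    Φ (A.J₂ (A.∼ a))     ≡⟨ Φ-J₂∼ a ⟩
    B.J₂ (B.∼ Φ a)       ≡⟨ sym (BB.J₀≡J₂∼ (Φ a)) ⟩
    B.J₀ (Φ a)           ∎
    where open ≡-Reasoning

  Φ-J₁ : ∀ a → Φ (A.J₁ a) ≡ B.J₁ (Φ a)
  Φ-J₁ a = begin
    Φ (A.J₁ a)                             ≡⟨ cong Φ (BA.J₁≡∼[J₂∨J₂∼] a) ⟩
    Φ (A.∼ (A.J₂ a A.∨ A.J₂ (A.∼ a)))      ≡⟨ Φ-∼ _ ⟩
    B.∼ Φ (A.J₂ a A.∨ A.J₂ (A.∼ a))        ≡⟨ cong B.∼_ (Φ-∨ _ _) ⟩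
    B.∼ (Φ (A.J₂ a) B.∨ Φ (A.J₂ (A.∼ a)))  ≡⟨ cong B.∼_ (cong₂ B._∨_ (Φ-J₂ a) (Φ-J₂∼ a)) ⟩
    B.∼ (B.J₂ (Φ a) B.∨ B.J₂ (B.∼ Φ a))    ≡⟨ sym (BB.J₁≡∼[J₂∨J₂∼] (Φ a)) ⟩
    B.J₁ (Φ a)                             ∎
    where open ≡-Reasoning

theorem2p15 :
    ((A : BAlg) → IsBochvar A → (D : PlonkaDecomposition A) → Part1 D × Part2 D) ×
    ((A B : BAlg) → IsBochvar A → IsBochvar B →
       (Φ : BAlg.Carrier A → BAlg.Carrier B) → IsReductIso A B Φ → PreservesJ A B Φ)
theorem2p15 = plonkaStructure , reductIso-preservesJ
  where
  plonkaStructure : (A : BAlg) → IsBochvar A → (D : PlonkaDecomposition A) → Part1 D × Part2 D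
  plonkaStructure A (X , f , f-emb) D = part1 , part2
    where open BochvarAlgebra.Decomposition X f f-emb D
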